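{- Let $G$ be a finite simple graph whose coline graph $L=\mathrm{co}(G)$ is tough, and let $C$ be a longest cycle of $L$. Then every connected component of $L-V(C)$ consists of a single vertex.
   Context: The coline graph $\mathrm{co}(G)$ of a graph $G$ has vertex set $E(G)$, two vertices $e\neq e'$ being adjacent iff $e,e'$ share no endpoint in $G$. A vertex cutset of $L$ is a set $S\subseteq V(L)$ with $L-S$ disconnected; $L$ is tough if $c(L-S)\le|S|$ for every vertex cutset $S$, where $c(\cdot)$ is the number of connected components. -}

module Defs where

open import Data.Nat using (ℕ; _≤_; _<_)
open import Data.Bool using (Bool; false; T)
open import Data.Fin using (Fin; toℕ)
open import Data.Product using (Σ; _×_; _,_; proj₁; proj₂; ∃)
open import Data.Empty using (⊥)
open import Data.List using (List; []; _∷_; length)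
open import Data.List.Membership.Propositional using (_∉_)
open import Data.List.Relation.Unary.All using (All)
open import Data.List.Relation.Unary.AllPairs using (AllPairs)
open import Data.List.Relation.Unary.Linked using (Linked)
open import Data.List.Relation.Unary.Unique.Propositional using (Unique)
open import Relation.Nullary using (¬_)
open import Relation.Binary.PropositionalEquality using (_≡_; _≢_)

record SimpleGraph (n : ℕ) : Set where
  field
    adj    : Fin n → Fin n → Bool
    sym    : ∀ u v → adj u v ≡ adj v u
    irrefl : ∀ u → adj u u ≡ false
open SimpleGraph public

-- An edge {u,v} is represented once, as the pair (u , v) with u < v.
Edge : ∀ {n} → SimpleGraph n → Set
Edge {n} G = Σ (Fin n × Fin n) λ p →
  (toℕ (proj₁ p) < toℕ (proj₂ p)) × T (adj G (proj₁ p) (proj₂ p))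

end₁ end₂ : ∀ {n} {G : SimpleGraph n} → Edge G → Fin n
end₁ e = proj₁ (proj₁ e)
end₂ e = proj₂ (proj₁ e)

CoAdj : ∀ {n} (G : SimpleGraph n) → Edge G → Edge G → Set
CoAdj G e f =
  e ≢ f × end₁ {G = G} e ≢ end₁ {G = G} f × end₁ {G = G} e ≢ end₂ {G = G} f
        × end₂ {G = G} e ≢ end₁ {G = G} f × end₂ {G = G} e ≢ end₂ {G = G} f

module _ {V : Set} (Adj : V → V → Set) where

  -- Conn P x y : there is a path from x to y all of whose vertices satisfy P
  -- (i.e. x and y lie in the same component of the subgraph induced by P).
  data Conn (P : V → Set) : V → V → Set where
    here : ∀ {x} → P x → Conn P x x
    step : ∀ {x y z} → P x → Adj x y → Conn P y z → Conn P x z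

  Outside : List V → V → Set
  Outside S v = v ∉ S

  Disconnected : List V → Set
  Disconnected S = ∃ λ x → ∃ λ y →
    Outside S x × Outside S y × ¬ Conn (Outside S) x y

  VertexCutset : List V → Set
  VertexCutset S = Unique S × Disconnected S

  -- xs is a family of vertices of L - S lying in pairwise distinct
  -- components of L - S.  c(L - S) is the largest length of such a family.
  PairwiseSeparated : List V → List V → Set
  PairwiseSeparated S xs =
    All (Outside S) xs × AllPairs (λ x y → ¬ Conn (Outside S) x y) xs

  Tough : Set
  Tough = ∀ S → VertexCutset S →
          ∀ xs → PairwiseSeparated S xs → length xs ≤ length S

  lastOr : V → List V → V
  lastOr x []       = x
  lastOr _ (y ∷ ys) = lastOr y ys

  Closes : List V → Set
  Closes []       = ⊥
  Closes (x ∷ xs) = Adj (lastOr x xs) x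

  IsCycle : List V → Set
  IsCycle C = Unique C × 3 ≤ length C × Linked Adj C × Closes C

  IsLongestCycle : List V → Set
  IsLongestCycle C = IsCycle C × (∀ D → IsCycle D → length D ≤ length C)

{-# OPTIONS --safe #-}
-- Suppose some component H of L − V(C) contains an edge ef. Let S be the vertices of C with a
-- neighbour in H and T their successors along C. Maximality of C forbids detours through H:
-- no vertex of T lies in S, and no two vertices of T are adjacent. In L − S the component of e
-- is H, and every other vertex is adjacent to neither e nor f. In a coline graph such
-- vertices are edges of G joining an endpoint of e to an endpoint of f, and they induce a
-- matching; so two vertices of T in one component of L − S would be equal or adjacent.
-- Hence e and T lie in |S| + 1 distinct components of L − S, contradicting toughness.
module Submission where

open import Data.Bool.Properties using (T-irrelevant)
open import Data.Empty using (⊥; ⊥-elim)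
open import Data.Fin using (Fin; toℕ) renaming (_≟_ to _≟ᶠ_)
open import Data.List using (List; []; _∷_; _++_; [_]; length; map; _ʳ++_)
open import Data.List.Properties using (length-++; ++-assoc; length-map; ∷-injectiveʳ)
open import Data.List.Membership.Propositional using (_∈_; _∉_)
open import Data.List.Membership.Propositional.Properties
  using (∈-∃++; ∈-map⁺; ∈-map⁻; ∈-++⁻; ∈-++⁺ˡ; ∈-++⁺ʳ)
open import Data.List.Relation.Binary.Disjoint.Propositional using (Disjoint)
import Data.List.Relation.Binary.Disjoint.Propositional.Properties as Disjoint
open import Data.List.Relation.Binary.Permutation.Propositional
  using (_↭_; ↭-refl; ↭-sym; ↭-trans; ↭-reflexive; ↭⇒↭ₛ; module PermutationReasoning)
open import Data.List.Relation.Binary.Permutation.Propositional.Properties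
  using (∈-resp-↭; ↭-length; ∷↭∷ʳ; ↭-reverse; ++⁺ˡ; ++⁺ʳ; ++-comm)
import Data.List.Relation.Binary.Permutation.Setoid.Properties as PermutationSetoid
import Data.List.Relation.Binary.Sublist.Propositional as Sublist
import Data.List.Relation.Binary.Sublist.Propositional.Properties as Sublist
open import Data.List.Relation.Binary.Subset.Propositional using (_⊆_)
open import Data.List.Relation.Unary.All as All using (All; []; _∷_)
import Data.List.Relation.Unary.All.Properties as All
open import Data.List.Relation.Unary.AllPairs as AllPairs using (AllPairs; []; _∷_)
import Data.List.Relation.Unary.AllPairs.Properties as AllPairs
open import Data.List.Relation.Unary.Any using (here; there)
open import Data.List.Relation.Unary.Linked using (Linked; []; [-]; _∷_)
open import Data.List.Relation.Unary.Unique.Propositional using (Unique)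
import Data.List.Relation.Unary.Unique.Propositional.Properties as Unique
open import Data.Nat using (ℕ; suc; _≤_; _<_; s≤s; z≤n)
open import Data.Nat.Properties using (≤-trans; <⇒≤; <⇒≱; <-asym; <-irrelevant; m<m+n; 1+n≰n)
open import Data.Product using (∃; ∃₂; _×_; _,_; proj₁; proj₂)
open import Data.Sum using (_⊎_; inj₁; inj₂)
open import Function using (_∘_)
open import Relation.Binary.Definitions using (Symmetric; DecidableEquality; _Respects_)
open import Relation.Binary.PropositionalEquality
  using (_≡_; _≢_; refl; sym; trans; cong; cong₂; subst; subst₂; setoid)
open import Relation.Nullary using (¬_; yes; no)
open import Relation.Nullary.Decidable using (¬¬-excluded-middle)

open import Defs hiding (sym)

module _ {A : Set} where

  Unique-resp-↭ : Unique {A = A} Respects _↭_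
  Unique-resp-↭ p = PermutationSetoid.Unique-resp-↭ (setoid A) (↭⇒↭ₛ p)

  Unique-++⁻ : ∀ xs {ys : List A} → Unique (xs ++ ys) → Unique xs × Unique ys × Disjoint xs ys
  Unique-++⁻ []       u = [] , u , λ ()
  Unique-++⁻ (x ∷ xs) (x∉ ∷ u) with Unique-++⁻ xs u
  ... | uxs , uys , xs#ys = All.++⁻ˡ xs x∉ ∷ uxs , uys , λ where
    (here refl , x∈ys) → All.lookup (All.++⁻ʳ xs x∉) x∈ys refl
    (there z∈xs , z∈ys) → xs#ys (z∈xs , z∈ys)

  Disjoint-outside : ∀ {xs ys C : List A} → xs ⊆ C → All (_∉ C) ys → Disjoint xs ys
  Disjoint-outside xs⊆C ys∉C (z∈xs , z∈ys) = All.lookup ys∉C z∈ys (xs⊆C z∈xs)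

  Disjoint-++ˡ : ∀ xs {ys zs : List A} → Disjoint xs zs → Disjoint ys zs → Disjoint (xs ++ ys) zs
  Disjoint-++ˡ xs xs#zs ys#zs (z∈xs++ys , z∈zs) with ∈-++⁻ xs z∈xs++ys
  ... | inj₁ z∈xs = xs#zs (z∈xs , z∈zs)
  ... | inj₂ z∈ys = ys#zs (z∈ys , z∈zs)

  AllPairs-resp-⊆ : ∀ {R : A → A → Set} {xs ys} → xs Sublist.⊆ ys → AllPairs R ys → AllPairs R xs
  AllPairs-resp-⊆ Sublist.[]         []         = []
  AllPairs-resp-⊆ (_ Sublist.∷ʳ τ)   (_ ∷ rys)  = AllPairs-resp-⊆ τ rys
  AllPairs-resp-⊆ (refl Sublist.∷ τ) (ry ∷ rys) = Sublist.All-resp-⊆ τ ry ∷ AllPairs-resp-⊆ τ rys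

  AllPairs-mapWith∈ : ∀ {R S : A → A → Set} {xs} → (∀ {x y} → x ∈ xs → y ∈ xs → R x y → S x y) →
                      AllPairs R xs → AllPairs S xs
  AllPairs-mapWith∈ f []         = []
  AllPairs-mapWith∈ f (rx ∷ rxs) =
    All.tabulate (λ y∈ → f (here refl) (there y∈) (All.lookup rx y∈)) ∷
    AllPairs-mapWith∈ (λ x∈ y∈ → f (there x∈) (there y∈)) rxs

  ¬¬-filter : (P : A → Set) (xs : List A) →
              ¬ ¬ (∃ λ ys → ys Sublist.⊆ xs × All P ys × (∀ {z} → z ∈ xs → P z → z ∈ ys))
  ¬¬-filter P []       k = k ([] , Sublist.[] , [] , λ ())
  ¬¬-filter P (x ∷ xs) k = ¬¬-filter P xs λ (ys , τ , pys , complete) → ¬¬-excluded-middle λ where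
    (yes px) → k (x ∷ ys , refl Sublist.∷ τ , px ∷ pys , λ where
      (here refl) _  → here refl
      (there z∈)  pz → there (complete z∈ pz))
    (no ¬px) → k (ys , x Sublist.∷ʳ τ , pys , λ where
      (here refl) px → ⊥-elim (¬px px)
      (there z∈)  pz → complete z∈ pz)

  pairs : List A → List (A × A)
  pairs (x ∷ y ∷ xs) = (x , y) ∷ pairs (y ∷ xs)
  pairs _            = []

  cyclePairs : List A → List (A × A)
  cyclePairs []       = []
  cyclePairs (x ∷ xs) = pairs (x ∷ xs ++ [ x ])

  map-proj₁-pairs-∷ʳ : ∀ x xs z → map proj₁ (pairs (x ∷ xs ++ [ z ])) ≡ x ∷ xs
  map-proj₁-pairs-∷ʳ x []       z = refl
  map-proj₁-pairs-∷ʳ x (y ∷ ys) z = cong (x ∷_) (map-proj₁-pairs-∷ʳ y ys z)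

  map-proj₂-pairs : ∀ x xs → map proj₂ (pairs (x ∷ xs)) ≡ xs
  map-proj₂-pairs x []       = refl
  map-proj₂-pairs x (y ∷ ys) = cong (y ∷_) (map-proj₂-pairs y ys)

  map-proj₁-cyclePairs : ∀ C → map proj₁ (cyclePairs C) ≡ C
  map-proj₁-cyclePairs []       = refl
  map-proj₁-cyclePairs (x ∷ xs) = map-proj₁-pairs-∷ʳ x xs x

  map-proj₂-cyclePairs : ∀ C → map proj₂ (cyclePairs C) ↭ C
  map-proj₂-cyclePairs []       = ↭-refl
  map-proj₂-cyclePairs (x ∷ xs) =
    ↭-trans (↭-reflexive (map-proj₂-pairs x (xs ++ [ x ]))) (↭-sym (∷↭∷ʳ x xs))

module Graph {V : Set} (_~_ : V → V → Set) where

  lastOr-++ : ∀ x xs y ys → lastOr _~_ x (xs ++ y ∷ ys) ≡ lastOr _~_ y ys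
  lastOr-++ x []       y ys = refl
  lastOr-++ x (z ∷ zs) y ys = lastOr-++ z zs y ys

  Linked-join : ∀ {x xs y ys} → Linked _~_ (x ∷ xs) → lastOr _~_ x xs ~ y → Linked _~_ (y ∷ ys) →
                Linked _~_ (x ∷ xs ++ y ∷ ys)
  Linked-join {xs = []}    [-]       r l = r ∷ l
  Linked-join {xs = _ ∷ _} (r′ ∷ l′) r l = r′ ∷ Linked-join l′ r l

  Linked-split : ∀ {x} xs {y ys} → Linked _~_ (x ∷ xs ++ y ∷ ys) →
                 Linked _~_ (x ∷ xs) × Linked _~_ (y ∷ ys)
  Linked-split []       (_ ∷ l) = [-] , l
  Linked-split (_ ∷ xs) (r ∷ l) with Linked-split xs l
  ... | l₁ , l₂ = r ∷ l₁ , l₂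

  pairs-∷ʳ : ∀ x xs z → pairs (x ∷ xs ++ [ z ]) ≡ pairs (x ∷ xs) ++ [ (lastOr _~_ x xs , z) ]
  pairs-∷ʳ x []       z = refl
  pairs-∷ʳ x (y ∷ ys) z = cong ((x , y) ∷_) (pairs-∷ʳ y ys z)

  ∈-pairs⁻ : ∀ {a b} x xs → (a , b) ∈ pairs (x ∷ xs) →
             ∃₂ λ ys zs → xs ≡ ys ++ b ∷ zs × lastOr _~_ x ys ≡ a
  ∈-pairs⁻ x (y ∷ zs) (here refl) = [] , zs , refl , refl
  ∈-pairs⁻ x (y ∷ zs) (there p∈) with ∈-pairs⁻ y zs p∈
  ... | ys , β , refl , eq = y ∷ ys , β , refl , eq

  record IsPath (x : V) (xs : List V) (y : V) : Set where
    constructor mkPath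
    field
      unique : Unique (x ∷ xs)
      linked : Linked _~_ (x ∷ xs)
      ends   : lastOr _~_ x xs ≡ y

  IsPath-join : ∀ {x xs y z zs w} → IsPath x xs y → y ~ z → IsPath z zs w →
                Disjoint (x ∷ xs) (z ∷ zs) → IsPath x (xs ++ z ∷ zs) w
  IsPath-join {x} {xs} {z = z} {zs} (mkPath u₁ l₁ refl) y~z (mkPath u₂ l₂ refl) disjoint =
    mkPath (Unique.++⁺ u₁ u₂ disjoint) (Linked-join l₁ y~z l₂) (lastOr-++ x xs z zs)

  IsPath-split : ∀ {x} xs {z zs w} → IsPath x (xs ++ z ∷ zs) w →
                 IsPath x xs (lastOr _~_ x xs) × IsPath z zs w × Disjoint (x ∷ xs) (z ∷ zs)
  IsPath-split {x} xs {z} {zs} (mkPath u l refl) with Unique-++⁻ (x ∷ xs) u | Linked-split xs l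
  ... | u₁ , u₂ , disjoint | l₁ , l₂ =
    mkPath u₁ l₁ refl , mkPath u₂ l₂ (sym (lastOr-++ x xs z zs)) , disjoint

  IsPath-close : ∀ {x xs y} → IsPath x xs y → y ~ x → 3 ≤ length (x ∷ xs) → IsCycle _~_ (x ∷ xs)
  IsPath-close (mkPath u l refl) y~x 3≤len = u , 3≤len , l , y~x

  CommonNonNeighbour : V → V → V → Set
  CommonNonNeighbour e f w = ¬ e ~ w × ¬ f ~ w

  InducesMatching : (V → Set) → Set
  InducesMatching P = ∀ {x y z} → P x → P y → P z → x ~ y → x ~ z → y ≡ z

  module _ {P : V → Set} where

    Conn-start : ∀ {x y} → Conn _~_ P x y → P x
    Conn-start (here px)     = px
    Conn-start (step px _ _) = px

    Conn-end : ∀ {x y} → Conn _~_ P x y → P y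
    Conn-end (here py)     = py
    Conn-end (step _ _ c)  = Conn-end c

    Conn-snoc : ∀ {x y z} → Conn _~_ P x y → y ~ z → P z → Conn _~_ P x z
    Conn-snoc (here px)      y~z pz = step px y~z (here pz)
    Conn-snoc (step px r c)  y~z pz = step px r (Conn-snoc c y~z pz)

    Conn-trans : ∀ {x y z} → Conn _~_ P x y → Conn _~_ P y z → Conn _~_ P x z
    Conn-trans (here _)      c′ = c′
    Conn-trans (step px r c) c′ = step px r (Conn-trans c c′)

    Conn-mono : ∀ {Q : V → Set} → (∀ {w} → P w → Q w) → ∀ {x y} → Conn _~_ P x y → Conn _~_ Q x y
    Conn-mono P⇒Q (here px)     = here (P⇒Q px)
    Conn-mono P⇒Q (step px r c) = step (P⇒Q px) r (Conn-mono P⇒Q c)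

    Conn-restrict : ∀ {Q : V → Set} → (∀ {u w} → P u → P w → u ~ w → Q u → Q w) →
                    ∀ {x y} → Q x → Conn _~_ P x y → Conn _~_ (λ w → P w × Q w) x y
    Conn-restrict closed qx (here px)     = here (px , qx)
    Conn-restrict closed qx (step px r c) =
      step (px , qx) r (Conn-restrict closed (closed px (Conn-start c) r qx) c)

    module _ (_≟_ : DecidableEquality V) where
      open import Data.List.Membership.DecPropositional _≟_ using (_∈?_)

      Conn⇒IsPath : ∀ {u v} → Conn _~_ P u v → ∃ λ qs → IsPath u qs v × All P (u ∷ qs)
      Conn⇒IsPath (here pu) = [] , mkPath ([] ∷ []) [-] refl , pu ∷ []
      Conn⇒IsPath {u} (step {y = w} pu u~w w⇝v) with Conn⇒IsPath w⇝v
      ... | ws , path@(mkPath uq lq eq) , pws with u ∈? (w ∷ ws)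
      ... | no u∉ = w ∷ ws , mkPath (All.¬Any⇒All¬ (w ∷ ws) u∉ ∷ uq) (u~w ∷ lq) eq , pu ∷ pws
      ... | yes u∈ with ∈-∃++ u∈
      ... | []      , suf , refl = ws , path , pws
      ... | _ ∷ pre , suf , refl =
        suf , proj₁ (proj₂ (IsPath-split pre path)) , All.++⁻ʳ (w ∷ pre) pws

  module _ (~-sym : Symmetric _~_) where

    Conn-sym : ∀ {P x y} → Conn _~_ P x y → Conn _~_ P y x
    Conn-sym (here px)     = here px
    Conn-sym (step px r c) = Conn-snoc (Conn-sym c) (~-sym r) px

    Conn-within-matching : ∀ {P} → InducesMatching P → ∀ {s t} → Conn _~_ P s t → s ≡ t ⊎ s ~ t
    Conn-within-matching {P} matching c = go (Conn-start c) (inj₁ refl) c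
      where
        go : ∀ {s w t} → P s → s ≡ w ⊎ s ~ w → Conn _~_ P w t → s ≡ t ⊎ s ~ t
        go _  s-w         (here _)         = s-w
        go Ps (inj₁ refl) (step _ w~w′ c)  = go Ps (inj₂ w~w′) c
        go Ps (inj₂ s~w)  (step Pw w~w′ c) =
          go Ps (inj₁ (matching Pw Ps (Conn-start c) (~-sym s~w) w~w′)) c

    private
      reverse-walk : ∀ {x} xs acc → Linked _~_ (x ∷ xs) → Linked _~_ (x ∷ acc) →
                     ∃ λ ys → xs ʳ++ x ∷ acc ≡ lastOr _~_ x xs ∷ ys
                            × Linked _~_ (lastOr _~_ x xs ∷ ys)
                            × lastOr _~_ (lastOr _~_ x xs) ys ≡ lastOr _~_ x acc
      reverse-walk []       acc _       l′ = acc , refl , l′ , refl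
      reverse-walk {x} (y ∷ ys) acc (r ∷ l) l′ = reverse-walk ys (x ∷ acc) l (~-sym r ∷ l′)

    IsPath-reverse : ∀ {x xs y} → IsPath x xs y → ∃ λ ys → y ∷ ys ↭ x ∷ xs × IsPath y ys x
    IsPath-reverse {x} {xs} (mkPath u l refl) with reverse-walk xs [] l [-]
    ... | ys , eq , l′ , ends = ys , reversed , mkPath (Unique-resp-↭ (↭-sym reversed) u) l′ ends
      where
        reversed : lastOr _~_ x xs ∷ ys ↭ x ∷ xs
        reversed = subst (_↭ x ∷ xs) eq (↭-reverse (x ∷ xs))

  ∈-cyclePairs⁻ : ∀ {p} x xs → p ∈ cyclePairs (x ∷ xs) →
                  p ∈ pairs (x ∷ xs) ⊎ p ≡ (lastOr _~_ x xs , x)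
  ∈-cyclePairs⁻ x xs p∈ with ∈-++⁻ (pairs (x ∷ xs)) (subst (_ ∈_) (pairs-∷ʳ x xs x) p∈)
  ... | inj₁ p∈pairs     = inj₁ p∈pairs
  ... | inj₂ (here refl) = inj₂ refl

  module _ {c c₂ : V} {cs : List V} where

    cyclePairs-rotate : cyclePairs (c₂ ∷ cs ++ [ c ]) ≡ pairs (c₂ ∷ cs ++ [ c ]) ++ [ (c , c₂) ]
    cyclePairs-rotate = trans (pairs-∷ʳ c₂ (cs ++ [ c ]) c₂)
      (cong (λ l → pairs (c₂ ∷ cs ++ [ c ]) ++ [ (l , c₂) ]) (lastOr-++ c₂ cs c []))

    cyclePairs-rotate-↭ : cyclePairs (c ∷ c₂ ∷ cs) ↭ cyclePairs (c₂ ∷ cs ++ [ c ])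
    cyclePairs-rotate-↭ = ↭-trans (∷↭∷ʳ (c , c₂) _) (↭-reflexive (sym cyclePairs-rotate))

    IsCycle-rotate : IsCycle _~_ (c ∷ c₂ ∷ cs) → IsCycle _~_ (c₂ ∷ cs ++ [ c ])
    IsCycle-rotate (u , 3≤len , c~c₂ ∷ l , closes) =
      Unique-resp-↭ rotated u ,
      subst (3 ≤_) (↭-length rotated) 3≤len ,
      Linked-join l closes [-] ,
      subst (_~ c₂) (sym (lastOr-++ c₂ cs c [])) c~c₂
      where
        rotated : c ∷ c₂ ∷ cs ↭ c₂ ∷ cs ++ [ c ]
        rotated = ∷↭∷ʳ c (c₂ ∷ cs)

  cyclePair-exists : ∀ {C} → IsCycle _~_ C → ∃ (_∈ cyclePairs C)
  cyclePair-exists {[]}        (_ , () , _)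
  cyclePair-exists {_ ∷ []}    _ = _ , here refl
  cyclePair-exists {_ ∷ _ ∷ _} _ = _ , here refl

  record Rotation (C : List V) (a b : V) : Set where
    constructor mkRotation
    field
      arc     : List V
      arc↭C   : b ∷ arc ↭ C
      isPath  : IsPath b arc a
      pairs↭  : cyclePairs C ↭ cyclePairs (b ∷ arc)

  private
    rotation′ : ∀ {a b} C → IsCycle _~_ C → ∀ pre {post} →
                cyclePairs C ≡ pre ++ (a , b) ∷ post → Rotation C a b
    rotation′ (_ ∷ []) (_ , s≤s () , _) _ _
    rotation′ (c ∷ c₂ ∷ cs) cycle [] refl with IsCycle-rotate cycle
    ... | u , _ , l , _ =
      mkRotation (cs ++ [ c ]) (↭-sym (∷↭∷ʳ c (c₂ ∷ cs))) (mkPath u l (lastOr-++ c₂ cs c []))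
                 cyclePairs-rotate-↭
    rotation′ (c ∷ c₂ ∷ cs) cycle (_ ∷ pre) {post} eq
      with rotation′ (c₂ ∷ cs ++ [ c ]) (IsCycle-rotate cycle) pre {post ++ [ (c , c₂) ]}
             (trans cyclePairs-rotate
               (trans (cong (_++ [ (c , c₂) ]) (∷-injectiveʳ eq)) (++-assoc pre _ _)))
    ... | mkRotation arc arc↭C path pairs↭ =
      mkRotation arc (↭-trans arc↭C (↭-sym (∷↭∷ʳ c (c₂ ∷ cs)))) path
                 (↭-trans cyclePairs-rotate-↭ pairs↭)

  rotation : ∀ {C a b} → IsCycle _~_ C → (a , b) ∈ cyclePairs C → Rotation C a b
  rotation {C} cycle ab∈ with ∈-∃++ ab∈
  ... | pre , post , eq = rotation′ C cycle pre eq

  module LongestCycle (~-sym : Symmetric _~_) (_≟_ : DecidableEquality V)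
                      {C : List V} (longest : IsLongestCycle _~_ C) where

    no-longer-cycle : ∀ {x xs y q qs} → IsPath x xs y → y ~ x → x ∷ xs ↭ C ++ q ∷ qs → ⊥
    no-longer-cycle {x} {xs} path y~x D↭ =
      <⇒≱ C<D (proj₂ longest (x ∷ xs) (IsPath-close path y~x (≤-trans 3≤C (<⇒≤ C<D))))
      where
        3≤C : 3 ≤ length C
        3≤C = proj₁ (proj₂ (proj₁ longest))
        C<D : length C < length (x ∷ xs)
        C<D = subst (length C <_) (sym (trans (↭-length D↭) (length-++ C)))
                    (m<m+n (length C) (s≤s z≤n))

    no-detour-between-neighbours : ∀ {a b u v} → (a , b) ∈ cyclePairs C → u ~ a → v ~ b →
                                   ¬ Conn _~_ (_∉ C) u v
    no-detour-between-neighbours ab∈ u~a v~b u⇝v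
      with rotation (proj₁ longest) ab∈ | Conn⇒IsPath _≟_ u⇝v
    ... | mkRotation _ arc↭C arc _ | _ , detour , detour∉C =
      no-longer-cycle (IsPath-join arc (~-sym u~a) detour (Disjoint-outside (∈-resp-↭ arc↭C) detour∉C))
                      v~b (++⁺ʳ _ arc↭C)

    -- The longer cycle is b ⋯ a′ v ⋯ u a ⋯ b′, with the second arc traversed backwards.
    no-detour-across-arcs : ∀ {b ys a′ b′ β a v qs u} →
      IsPath b ys a′ → IsPath b′ β a → Disjoint (b ∷ ys) (b′ ∷ β) → b ∷ ys ++ b′ ∷ β ↭ C →
      IsPath v qs u → All (_∉ C) (v ∷ qs) → a′ ~ v → u ~ a → ¬ b ~ b′
    no-detour-across-arcs {b} {ys} {b′ = b′} {β} {a} {v} {qs}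
                          arc₁ arc₂ arcs# arcs↭C detour detour∉C a′~v u~a b~b′
      with IsPath-reverse ~-sym arc₂
    ... | β′ , arc₂↭ , arc₂′ =
      no-longer-cycle (IsPath-join (IsPath-join arc₁ a′~v detour disjoint₁) u~a arc₂′ disjoint₂)
                      (~-sym b~b′) perm
      where
        arc₁⊆C : (b ∷ ys) ⊆ C
        arc₁⊆C z∈ = ∈-resp-↭ arcs↭C (∈-++⁺ˡ z∈)
        arc₂′⊆C : (a ∷ β′) ⊆ C
        arc₂′⊆C z∈ = ∈-resp-↭ arcs↭C (∈-++⁺ʳ (b ∷ ys) (∈-resp-↭ arc₂↭ z∈))
        disjoint₁ : Disjoint (b ∷ ys) (v ∷ qs)
        disjoint₁ = Disjoint-outside arc₁⊆C detour∉C
        disjoint₂ : Disjoint (b ∷ ys ++ v ∷ qs) (a ∷ β′)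
        disjoint₂ = Disjoint-++ˡ (b ∷ ys) (λ (z∈₁ , z∈₂) → arcs# (z∈₁ , ∈-resp-↭ arc₂↭ z∈₂))
                                  (Disjoint.sym (Disjoint-outside arc₂′⊆C detour∉C))
        perm : b ∷ (ys ++ v ∷ qs) ++ a ∷ β′ ↭ C ++ v ∷ qs
        perm = begin
          ((b ∷ ys) ++ v ∷ qs) ++ a ∷ β′  ≡⟨ ++-assoc (b ∷ ys) _ _ ⟩
          (b ∷ ys) ++ (v ∷ qs) ++ a ∷ β′  ↭⟨ ++⁺ˡ (b ∷ ys) (++⁺ˡ (v ∷ qs) arc₂↭) ⟩
          (b ∷ ys) ++ (v ∷ qs) ++ b′ ∷ β  ↭⟨ ++⁺ˡ (b ∷ ys) (++-comm (v ∷ qs) (b′ ∷ β)) ⟩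
          (b ∷ ys) ++ (b′ ∷ β) ++ v ∷ qs  ≡⟨ ++-assoc (b ∷ ys) _ _ ⟨
          ((b ∷ ys) ++ b′ ∷ β) ++ v ∷ qs  ↭⟨ ++⁺ʳ (v ∷ qs) arcs↭C ⟩
          C ++ v ∷ qs                     ∎
          where open PermutationReasoning

    no-detour-with-adjacent-successors : ∀ {a b a′ b′ u v} →
      (a , b) ∈ cyclePairs C → (a′ , b′) ∈ cyclePairs C → a ≢ a′ →
      u ~ a → v ~ a′ → Conn _~_ (_∉ C) v u → ¬ b ~ b′
    no-detour-with-adjacent-successors ab∈ a′b′∈ a≢a′ u~a v~a′ v⇝u
      with rotation (proj₁ longest) ab∈ | Conn⇒IsPath _≟_ v⇝u
    ... | mkRotation r arc↭C arc pairs↭ | _ , detour , detour∉C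
      with ∈-cyclePairs⁻ _ r (∈-resp-↭ pairs↭ a′b′∈)
    ... | inj₂ refl = ⊥-elim (a≢a′ (sym (IsPath.ends arc)))
    ... | inj₁ a′b′∈arc with ∈-pairs⁻ _ r a′b′∈arc
    ... | ys , _ , refl , refl with IsPath-split ys arc
    ... | arc₁ , arc₂ , arcs# =
      no-detour-across-arcs arc₁ arc₂ arcs# arc↭C detour detour∉C (~-sym v~a′) u~a

  module ToughLongestCycle (~-sym : Symmetric _~_) (_≟_ : DecidableEquality V)
                           (matching : ∀ {e f} → e ~ f → InducesMatching (CommonNonNeighbour e f))
                           (tough : Tough _~_) {C : List V} (longest : IsLongestCycle _~_ C) where

    open LongestCycle ~-sym _≟_ longest
    open import Data.List.Membership.DecPropositional _≟_ using (_∈?_)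

    fst∈C : ∀ {p} → p ∈ cyclePairs C → proj₁ p ∈ C
    fst∈C p∈ = subst (_ ∈_) (map-proj₁-cyclePairs C) (∈-map⁺ proj₁ p∈)

    snd∈C : ∀ {p} → p ∈ cyclePairs C → proj₂ p ∈ C
    snd∈C p∈ = ∈-resp-↭ (map-proj₂-cyclePairs C) (∈-map⁺ proj₂ p∈)

    cyclePairs-distinct : AllPairs (λ p q → proj₁ p ≢ proj₁ q × proj₂ p ≢ proj₂ q) (cyclePairs C)
    cyclePairs-distinct = AllPairs.zip
      ( AllPairs.map⁻ (subst Unique (sym (map-proj₁-cyclePairs C)) (proj₁ (proj₁ longest)))
      , AllPairs.map⁻ (Unique-resp-↭ (↭-sym (map-proj₂-cyclePairs C)) (proj₁ (proj₁ longest))))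

    module _ {e f : V} (e~f : e ~ f) (e∉C : e ∉ C) (f∉C : f ∉ C) where

      InComponent : V → Set
      InComponent = Conn _~_ (_∉ C) e

      Attached : V → Set
      Attached a = ∃ λ u → InComponent u × u ~ a

      detour : ∀ {u v} → InComponent u → InComponent v → Conn _~_ (_∉ C) u v
      detour hu hv = Conn-trans (Conn-sym ~-sym hu) hv

      module _ (ps : List (V × V)) (ps⊆ : ps Sublist.⊆ cyclePairs C)
               (attached : All (Attached ∘ proj₁) ps)
               (complete : ∀ {p} → p ∈ cyclePairs C → Attached (proj₁ p) → p ∈ ps) where

        attachments successors : List V
        attachments = map proj₁ ps
        successors  = map proj₂ ps

        ps∈ : ∀ {p} → p ∈ ps → p ∈ cyclePairs C
        ps∈ = Sublist.Any-resp-⊆ ps⊆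

        ∈attachments⁻ : ∀ {a} → a ∈ attachments → a ∈ C × Attached a
        ∈attachments⁻ a∈ with ∈-map⁻ proj₁ a∈
        ... | p , p∈ , refl = fst∈C (ps∈ p∈) , All.lookup attached p∈

        ∈attachments⁺ : ∀ {a} → a ∈ C → Attached a → a ∈ attachments
        ∈attachments⁺ {a} a∈C att with ∈-map⁻ proj₁ (subst (a ∈_) (sym (map-proj₁-cyclePairs C)) a∈C)
        ... | p , p∈ , refl = ∈-map⁺ proj₁ (complete p∈ att)

        component-extends : ∀ {u w} → InComponent u → u ~ w → w ∉ attachments → InComponent w
        component-extends {u} {w} hu u~w w∉ with w ∈? C
        ... | yes w∈C = ⊥-elim (w∉ (∈attachments⁺ w∈C (u , hu , u~w)))
        ... | no  w∉C = Conn-snoc hu u~w w∉C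

        component-closed : ∀ {s t} → Conn _~_ (_∉ attachments) s t → InComponent s → InComponent t
        component-closed c hs =
          proj₂ (Conn-end (Conn-restrict (λ _ w∉ u~w hu → component-extends hu u~w w∉) hs c))

        unreachable-from-e : ∀ {y} → y ∈ C → ¬ Conn _~_ (_∉ attachments) e y
        unreachable-from-e y∈C c = Conn-end (component-closed c (here e∉C)) y∈C

        away-from-component : ∀ {s t} → ¬ InComponent s → Conn _~_ (_∉ attachments) s t → s ≡ t ⊎ s ~ t
        away-from-component ¬hs c =
          Conn-within-matching ~-sym (matching e~f) (Conn-mono non-neighbour
            (Conn-restrict (λ u∉ _ u~w ¬hu hw → ¬hu (component-extends hw (~-sym u~w) u∉)) ¬hs c))
          where
            non-neighbour : ∀ {w} → w ∉ attachments × ¬ InComponent w → CommonNonNeighbour e f w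
            non-neighbour (w∉ , ¬hw) =
              (λ e~w → ¬hw (component-extends (here e∉C) e~w w∉)) ,
              (λ f~w → ¬hw (component-extends (step e∉C e~f (here f∉C)) f~w w∉))

        successor∉attachments : ∀ {p} → p ∈ ps → proj₂ p ∉ attachments
        successor∉attachments p∈ b∈ with All.lookup attached p∈ | proj₂ (∈attachments⁻ b∈)
        ... | u , hu , u~a | v , hv , v~b =
          no-detour-between-neighbours (ps∈ p∈) u~a v~b (detour hu hv)

        successors-separated : ∀ {p q} → p ∈ ps → q ∈ ps → proj₁ p ≢ proj₁ q × proj₂ p ≢ proj₂ q →
                               ¬ Conn _~_ (_∉ attachments) (proj₂ p) (proj₂ q)
        successors-separated p∈ q∈ (a≢a′ , b≢b′) c
          with away-from-component (λ hb → Conn-end hb (snd∈C (ps∈ p∈))) c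
        ... | inj₁ b≡b′ = b≢b′ b≡b′
        ... | inj₂ b~b′ with All.lookup attached p∈ | All.lookup attached q∈
        ... | u , hu , u~a | v , hv , v~a′ =
          no-detour-with-adjacent-successors (ps∈ p∈) (ps∈ q∈) a≢a′ u~a v~a′ (detour hv hu) b~b′

        e∉attachments : e ∉ attachments
        e∉attachments e∈ = e∉C (proj₁ (∈attachments⁻ e∈))

        separated : PairwiseSeparated _~_ attachments (e ∷ successors)
        separated =
          e∉attachments ∷ All.map⁺ (All.tabulate successor∉attachments) ,
          All.map⁺ (All.tabulate (unreachable-from-e ∘ snd∈C ∘ ps∈)) ∷
          AllPairs.map⁺ (AllPairs-mapWith∈ successors-separated
                                           (AllPairs-resp-⊆ ps⊆ cyclePairs-distinct))

        cycle-vertex-outside : ∃ λ y → y ∈ C × y ∉ attachments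
        cycle-vertex-outside with cyclePair-exists (proj₁ longest)
        ... | (a , b) , ab∈ with a ∈? attachments
        ... | no  a∉ = a , fst∈C ab∈ , a∉
        ... | yes a∈ = b , snd∈C ab∈ , successor∉attachments (complete ab∈ (proj₂ (∈attachments⁻ a∈)))

        cutset : VertexCutset _~_ attachments
        cutset with cycle-vertex-outside
        ... | y , y∈C , y∉ =
          AllPairs.map⁺ (AllPairs.map proj₁ (AllPairs-resp-⊆ ps⊆ cyclePairs-distinct)) ,
          e , y , e∉attachments , y∉ , unreachable-from-e y∈C

        too-many-components : ⊥
        too-many-components = 1+n≰n
          (subst₂ (λ m n → suc m ≤ n) (length-map proj₂ ps) (length-map proj₁ ps)
                  (tough attachments cutset (e ∷ successors) separated))

      -- Being attached to the component is not decidable in general, but the goal is ⊥,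
      -- so the pairs of C with an attached first vertex can be selected classically.
      no-edge-outside : ⊥
      no-edge-outside = ¬¬-filter (Attached ∘ proj₁) (cyclePairs C)
        λ (ps , ps⊆ , attached , complete) → too-many-components ps ps⊆ attached complete

    Conn-outside⇒≡ : ∀ {x y} → Conn _~_ (_∉ C) x y → x ≡ y
    Conn-outside⇒≡ (here _)           = refl
    Conn-outside⇒≡ (step x∉C x~w w⇝y) = ⊥-elim (no-edge-outside x~w x∉C (Conn-start w⇝y))

module Coline {n : ℕ} (G : SimpleGraph n) where

  open Graph (CoAdj G) using (CommonNonNeighbour; InducesMatching)

  lo hi : Edge G → Fin n
  lo = end₁ {G = G}
  hi = end₂ {G = G}

  data Endpoint (x : Edge G) : Fin n → Set where
    lo-end : Endpoint x (lo x)
    hi-end : Endpoint x (hi x)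

  data Joins (x : Edge G) (p q : Fin n) : Set where
    forward  : lo x ≡ p → hi x ≡ q → Joins x p q
    backward : lo x ≡ q → hi x ≡ p → Joins x p q

  edge-≡ : ∀ {x y : Edge G} → lo x ≡ lo y → hi x ≡ hi y → x ≡ y
  edge-≡ {(_ , l , t)} {(_ , l′ , t′)} refl refl =
    cong₂ (λ l t → (_ , l , t)) (<-irrelevant l l′) (T-irrelevant t t′)

  edge-not-flipped : ∀ x y → lo x ≡ hi y → hi x ≡ lo y → ⊥
  edge-not-flipped (_ , x< , _) (_ , y< , _) l≡h h≡l =
    <-asym y< (subst₂ (λ a b → toℕ a < toℕ b) l≡h h≡l x<)

  _≟ₑ_ : DecidableEquality (Edge G)
  x ≟ₑ y with lo x ≟ᶠ lo y | hi x ≟ᶠ hi y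
  ... | yes lo≡ | yes hi≡ = yes (edge-≡ lo≡ hi≡)
  ... | no  lo≢ | _       = no (lo≢ ∘ cong lo)
  ... | yes _   | no  hi≢ = no (hi≢ ∘ cong hi)

  coline-sym : Symmetric (CoAdj G)
  coline-sym (x≢y , ll , lh , hl , hh) = x≢y ∘ sym , ll ∘ sym , hl ∘ sym , lh ∘ sym , hh ∘ sym

  CoAdj⇒endpoints-distinct : ∀ {x y p q} → CoAdj G x y → Endpoint x p → Endpoint y q → p ≢ q
  CoAdj⇒endpoints-distinct (_ , ll , _  , _  , _ ) lo-end lo-end = ll
  CoAdj⇒endpoints-distinct (_ , _  , lh , _  , _ ) lo-end hi-end = lh
  CoAdj⇒endpoints-distinct (_ , _  , _  , hl , _ ) hi-end lo-end = hl
  CoAdj⇒endpoints-distinct (_ , _  , _  , _  , hh) hi-end hi-end = hh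

  ¬CoAdj⇒common-endpoint : ∀ x y → ¬ CoAdj G x y → ∃ λ p → Endpoint x p × Endpoint y p
  ¬CoAdj⇒common-endpoint x y ¬x~y with lo x ≟ᶠ lo y | lo x ≟ᶠ hi y | hi x ≟ᶠ lo y | hi x ≟ᶠ hi y
  ... | yes eq | _      | _      | _      = lo x , lo-end , subst (Endpoint y) (sym eq) lo-end
  ... | no _   | yes eq | _      | _      = lo x , lo-end , subst (Endpoint y) (sym eq) hi-end
  ... | no _   | no _   | yes eq | _      = hi x , hi-end , subst (Endpoint y) (sym eq) lo-end
  ... | no _   | no _   | no _   | yes eq = hi x , hi-end , subst (Endpoint y) (sym eq) hi-end
  ... | no ll  | no lh  | no hl  | no hh  = ⊥-elim (¬x~y (ll ∘ cong lo , ll , lh , hl , hh))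

  distinct-endpoints-join : ∀ {x p q} → Endpoint x p → Endpoint x q → p ≢ q → Joins x p q
  distinct-endpoints-join lo-end lo-end p≢q = ⊥-elim (p≢q refl)
  distinct-endpoints-join lo-end hi-end _   = forward refl refl
  distinct-endpoints-join hi-end lo-end _   = backward refl refl
  distinct-endpoints-join hi-end hi-end p≢q = ⊥-elim (p≢q refl)

  Joins-sym : ∀ {x p q} → Joins x p q → Joins x q p
  Joins-sym (forward  l h) = backward l h
  Joins-sym (backward l h) = forward l h

  Joins⇒Endpoint : ∀ {x p q} → Joins x p q → Endpoint x p
  Joins⇒Endpoint (forward  refl _) = lo-end
  Joins⇒Endpoint (backward _ refl) = hi-end

  Joins-unique : ∀ {y z p q} → Joins y p q → Joins z p q → y ≡ z
  Joins-unique (forward  l₁ h₁) (forward  l₂ h₂) = edge-≡ (trans l₁ (sym l₂)) (trans h₁ (sym h₂))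
  Joins-unique (backward l₁ h₁) (backward l₂ h₂) = edge-≡ (trans l₁ (sym l₂)) (trans h₁ (sym h₂))
  Joins-unique {y} {z} (forward  l₁ h₁) (backward l₂ h₂) =
    ⊥-elim (edge-not-flipped y z (trans l₁ (sym h₂)) (trans h₁ (sym l₂)))
  Joins-unique {y} {z} (backward l₁ h₁) (forward  l₂ h₂) =
    ⊥-elim (edge-not-flipped y z (trans l₁ (sym h₂)) (trans h₁ (sym l₂)))

  other-endpoint-unique : ∀ {x p q r} → Endpoint x p → Endpoint x q → Endpoint x r →
                          p ≢ q → p ≢ r → q ≡ r
  other-endpoint-unique lo-end lo-end _      p≢q _   = ⊥-elim (p≢q refl)
  other-endpoint-unique lo-end hi-end lo-end _   p≢r = ⊥-elim (p≢r refl)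
  other-endpoint-unique lo-end hi-end hi-end _   _   = refl
  other-endpoint-unique hi-end hi-end _      p≢q _   = ⊥-elim (p≢q refl)
  other-endpoint-unique hi-end lo-end hi-end _   p≢r = ⊥-elim (p≢r refl)
  other-endpoint-unique hi-end lo-end lo-end _   _   = refl

  CoAdj-Joins-apart : ∀ {x y p q p′ q′} → CoAdj G x y → Joins x p q → Joins y p′ q′ → p ≢ p′
  CoAdj-Joins-apart x~y jx jy = CoAdj⇒endpoints-distinct x~y (Joins⇒Endpoint jx) (Joins⇒Endpoint jy)

  CommonNonNeighbour⇒Joins : ∀ e f x → CoAdj G e f → CommonNonNeighbour e f x →
                             ∃₂ λ p q → Endpoint e p × Endpoint f q × Joins x p q
  CommonNonNeighbour⇒Joins e f x e~f (¬e~x , ¬f~x)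
    with ¬CoAdj⇒common-endpoint e x ¬e~x | ¬CoAdj⇒common-endpoint f x ¬f~x
  ... | p , ep , xp | q , fq , xq =
    p , q , ep , fq , distinct-endpoints-join xp xq (CoAdj⇒endpoints-distinct e~f ep fq)

  coline-matching : ∀ {e f} → CoAdj G e f → InducesMatching (CommonNonNeighbour e f)
  coline-matching {e} {f} e~f {x} {y} {z} x-non y-non z-non x~y x~z
    with CommonNonNeighbour⇒Joins e f x e~f x-non | CommonNonNeighbour⇒Joins e f y e~f y-non
       | CommonNonNeighbour⇒Joins e f z e~f z-non
  ... | _ , _ , ep , fq , jx | _ , _ , ep′ , fq′ , jy | _ , _ , ep″ , fq″ , jz
    with other-endpoint-unique ep ep′ ep″ (CoAdj-Joins-apart x~y jx jy) (CoAdj-Joins-apart x~z jx jz)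
       | other-endpoint-unique fq fq′ fq″ (CoAdj-Joins-apart x~y (Joins-sym jx) (Joins-sym jy))
                                          (CoAdj-Joins-apart x~z (Joins-sym jx) (Joins-sym jz))
  ... | refl | refl = Joins-unique jy jz

lemma2p5 : (n : ℕ) (G : SimpleGraph n) → Tough (CoAdj G) →
    (C : List (Edge G)) → IsLongestCycle (CoAdj G) C →
    ∀ x y → x ∉ C → y ∉ C → Conn (CoAdj G) (Outside (CoAdj G) C) x y → x ≡ y
lemma2p5 n G tough C longest x y _ _ =
  Graph.ToughLongestCycle.Conn-outside⇒≡ (CoAdj G) coline-sym _≟ₑ_ coline-matching tough longest
  where open Coline G
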